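{- Let $G$ be a finite abelian group. Let $B=\{x\in G : 2x=0\}$, and let $A\subseteq G$ be a subset such that $G\setminus B = A\cup(-A)$ with $A\cap(-A)=\emptyset$. Then $g^2(G)=|A|+|B|+1$.
   Context: For a finite abelian group $G$ (written additively) and a positive integer $k$, the $k$-Harborth constant $g^k(G)$ is the smallest positive integer $t$ such that every subset $S\subseteq G$ with $|S|\ge t$ contains a subset $T$ with $|T|=k$ and $\sum_{x\in T}x=0$ (a $k$-zero-sum subset). Here $-A=\{ -a: a\in A\}$. -}

module Defs where

open import Level using (0ℓ)
open import Data.Nat using (ℕ; zero; suc; _≤_)
open import Data.Bool using (Bool; true; false; if_then_else_)
open import Data.Fin using (Fin)
import Data.Fin.Properties as FinP
open import Data.List using (List; foldr; allFin; filter; length)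
open import Data.Product using (Σ; ∃; _×_; _,_)
open import Data.Sum using (_⊎_)
open import Function.Bundles using (_↔_; Inverse)
open import Algebra.Structures using (IsAbelianGroup)
open import Relation.Binary.PropositionalEquality using (_≡_; refl; cong; sym; trans)
open import Relation.Binary.Definitions using (DecidableEquality)
open import Relation.Nullary using (¬_; yes; no; does)

record FiniteAbelianGroup : Set₁ where
  infixl 6 _+_
  field
    Carrier : Set
    _+_     : Carrier → Carrier → Carrier
    0#      : Carrier
    -_      : Carrier → Carrier
    isAbelianGroup : IsAbelianGroup _≡_ _+_ 0# -_
    size    : ℕ
    enum    : Fin size ↔ Carrier

  open Inverse enum using (to; from; strictlyInverseˡ)

  _≟_ : DecidableEquality Carrier
  x ≟ y with FinP._≟_ (from x) (from y)
  ... | yes p = yes (trans (sym (strictlyInverseˡ x))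
                      (trans (cong to p) (strictlyInverseˡ y)))
  ... | no ¬p = no (λ x≡y → ¬p (cong from x≡y))

  Subset : Set
  Subset = Carrier → Bool

  _∈_ : Carrier → Subset → Set
  x ∈ S = S x ≡ true

  _⊆_ : Subset → Subset → Set
  S ⊆ T = ∀ x → x ∈ S → x ∈ T

  elements : List Carrier
  elements = Data.List.map to (allFin size)

  card : Subset → ℕ
  card S = length (filter (λ x → S x Data.Bool.≟ true) elements)

  sumOf : Subset → Carrier
  sumOf T = foldr (λ x acc → if T x then x + acc else acc) 0# elements

  HasZeroSumSubset : ℕ → Subset → Set
  HasZeroSumSubset k S = Σ Subset λ T → T ⊆ S × card T ≡ k × sumOf T ≡ 0#

  HarborthProperty : ℕ → ℕ → Set
  HarborthProperty k t = ∀ (S : Subset) → t ≤ card S → HasZeroSumSubset k S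

  -- "g^k(G) = m": m is the smallest positive integer with the property
  IsHarborthConstant : ℕ → ℕ → Set
  IsHarborthConstant k m =
    1 ≤ m × HarborthProperty k m × (∀ t → 1 ≤ t → HarborthProperty k t → m ≤ t)

  B : Subset
  B x = does ((x + x) ≟ 0#)

-- Pairs {x, -x} with x ∉ B are exactly the 2-element zero-sum subsets. A ∪ B contains no
-- such pair and has |A| + |B| elements, giving the lower bound. Conversely, if S contains
-- no such pair, then negation maps S ∖ (A ∪ B) into A ∖ S, so |S| ≤ |B| + |A ∩ S| + |A ∖ S|
-- = |A| + |B|.

module Submission where

open import Algebra.Bundles using (AbelianGroup)
open import Algebra.Core using (Op₂)
import Algebra.Properties.Group as GroupProperties
open import Algebra.Structures using (IsAbelianGroup; IsCommutativeMonoid)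
open import Data.Bool using (Bool; true; false; _∧_; _∨_; not; if_then_else_)
import Data.Bool as Bool
open import Data.Bool.Properties using (∧-conicalˡ; ∧-conicalʳ; not-injective; ¬-not)
open import Data.Fin using (Fin)
open import Data.Fin.Permutation using (permutation)
open import Data.List using (List; []; _∷_; filter; length; foldr; tabulate)
open import Data.List.Membership.Propositional using (lose) renaming (_∈_ to _∈ₗ_)
open import Data.List.Membership.Propositional.Properties using (∈-map⁺; ∈-allFin)
open import Data.List.Properties using (map-tabulate)
open import Data.List.Relation.Unary.All as All using (All; []; _∷_)
open import Data.List.Relation.Unary.Any using (here; there; any?; satisfied)
open import Data.List.Relation.Unary.Unique.Propositional using (Unique; _∷_)
open import Data.List.Relation.Unary.Unique.Propositional.Properties using (map⁺; allFin⁺)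
import Data.Nat as ℕ
open import Data.Nat using (ℕ; suc; _≤_; _<_; z≤n; s≤s)
import Data.Nat.Properties as ℕₚ
open import Algebra.Properties.CommutativeMonoid.Sum ℕₚ.+-0-commutativeMonoid
  using (sum; sum-permute; sum-cong-≗)
open import Data.Product using (_×_; ∃-syntax; ∃₂; _,_; proj₁; proj₂)
open import Data.Sum using (_⊎_; inj₁; inj₂)
import Data.Sum as Sum
open import Defs
open import Function using (id; _∘_)
open import Function.Bundles using (_⇔_; Equivalence; Inverse; Injection)
open import Function.Properties.Inverse using (↔⇒↣)
open import Relation.Binary.Definitions using (DecidableEquality)
open import Relation.Binary.PropositionalEquality
  using (_≡_; _≢_; refl; sym; trans; cong; cong₂; subst; module ≡-Reasoning)
open import Relation.Nullary using (¬_; Dec; yes; no; does; contradiction)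
open import Relation.Nullary.Decidable using (dec-true; dec-false; map′; _×-dec_)

module _ {X : Set} where

  infixr 7 _∩_ _∖_
  infixr 6 _∪_

  _∩_ _∪_ _∖_ : (X → Bool) → (X → Bool) → X → Bool
  (P ∩ Q) x = P x ∧ Q x
  (P ∪ Q) x = P x ∨ Q x
  (P ∖ Q) x = P x ∧ not (Q x)

  module _ (P Q : X → Bool) {x : X} where

    ∩⁺ : P x ≡ true → Q x ≡ true → (P ∩ Q) x ≡ true
    ∩⁺ Px Qx rewrite Px | Qx = refl

    ∩⁻ : (P ∩ Q) x ≡ true → P x ≡ true × Q x ≡ true
    ∩⁻ h = ∧-conicalˡ (P x) (Q x) h , ∧-conicalʳ (P x) (Q x) h

    ∖⁺ : P x ≡ true → Q x ≡ false → (P ∖ Q) x ≡ true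
    ∖⁺ Px Qx rewrite Px | Qx = refl

    ∖⁻ : (P ∖ Q) x ≡ true → P x ≡ true × Q x ≡ false
    ∖⁻ h = ∧-conicalˡ (P x) _ h , not-injective {y = false} (∧-conicalʳ (P x) _ h)

    ∪⁻ : (P ∪ Q) x ≡ true → P x ≡ true ⊎ Q x ≡ true
    ∪⁻ h with P x
    ... | true  = inj₁ refl
    ... | false = inj₂ h

  count : (X → Bool) → List X → ℕ
  count P []       = 0
  count P (x ∷ xs) = if P x then suc (count P xs) else count P xs

  length-filter≡count : ∀ P xs → length (filter (λ x → P x Bool.≟ true) xs) ≡ count P xs
  length-filter≡count P []       = refl
  length-filter≡count P (x ∷ xs) with P x
  ... | true  = cong suc (length-filter≡count P xs)
  ... | false = length-filter≡count P xs

  count-mono : ∀ {P Q} → (∀ x → P x ≡ true → Q x ≡ true) → ∀ xs → count P xs ≤ count Q xs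
  count-mono P⊆Q []       = z≤n
  count-mono {P} {Q} P⊆Q (x ∷ xs) with P x in Px | Q x in Qx
  ... | true  | true  = s≤s (count-mono P⊆Q xs)
  ... | true  | false = contradiction (trans (sym (P⊆Q x Px)) Qx) λ ()
  ... | false | true  = ℕₚ.m≤n⇒m≤1+n (count-mono P⊆Q xs)
  ... | false | false = count-mono P⊆Q xs

  count-split : ∀ P Q xs → count P xs ≡ count (P ∩ Q) xs ℕ.+ count (P ∖ Q) xs
  count-split P Q []       = refl
  count-split P Q (x ∷ xs) with P x | Q x
  ... | true  | true  = cong suc (count-split P Q xs)
  ... | true  | false = trans (cong suc (count-split P Q xs)) (sym (ℕₚ.+-suc _ _))
  ... | false | _     = count-split P Q xs

  count-∪-disjoint : ∀ {P Q} → (∀ x → P x ≡ true → Q x ≡ false) →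
                     ∀ xs → count (P ∪ Q) xs ≡ count P xs ℕ.+ count Q xs
  count-∪-disjoint P∩Q≡∅ []       = refl
  count-∪-disjoint {P} {Q} P∩Q≡∅ (x ∷ xs) with P x in Px | Q x in Qx
  ... | true  | true  = contradiction (trans (sym Qx) (P∩Q≡∅ x Px)) λ ()
  ... | true  | false = cong suc (count-∪-disjoint P∩Q≡∅ xs)
  ... | false | true  = trans (cong suc (count-∪-disjoint P∩Q≡∅ xs)) (sym (ℕₚ.+-suc _ _))
  ... | false | false = count-∪-disjoint P∩Q≡∅ xs

  count-none : ∀ {P xs} → All (λ x → P x ≡ false) xs → count P xs ≡ 0
  count-none []                   = refl
  count-none {P} (Px≡false ∷ rest) rewrite Px≡false = count-none rest

  count-tabulate : ∀ P {n} (f : Fin n → X) →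
                   count P (tabulate f) ≡ sum (λ i → if P (f i) then 1 else 0)
  count-tabulate P {ℕ.zero} f = refl
  count-tabulate P {suc n}  f with P (f Fin.zero)
  ... | true  = cong suc (count-tabulate P (f ∘ Fin.suc))
  ... | false = count-tabulate P (f ∘ Fin.suc)

module Singletons {X : Set} (_≟_ : DecidableEquality X) where

  ⁅_⁆ : X → X → Bool
  ⁅ x ⁆ y = does (y ≟ x)

  ∈⁅⁆∪⁅⁆ : ∀ {x y z} → (⁅ x ⁆ ∪ ⁅ y ⁆) z ≡ true → z ≡ x ⊎ z ≡ y
  ∈⁅⁆∪⁅⁆ {x} {y} {z} h with z ≟ x | z ≟ y | h
  ... | yes z≡x | _       | _ = inj₁ z≡x
  ... | no _    | yes z≡y | _ = inj₂ z≡y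
  ... | no _    | no _    | ()

  count-⁅⁆ : ∀ {x xs} → Unique xs → x ∈ₗ xs → count ⁅ x ⁆ xs ≡ 1
  count-⁅⁆ {x} {y ∷ ys} (y∉ys ∷ u) x∈ with y ≟ x | x∈
  ... | yes refl | _          = cong suc (count-none (All.map (λ y≢z → dec-false (_ ≟ y) (y≢z ∘ sym)) y∉ys))
  ... | no y≢x   | here x≡y   = contradiction (sym x≡y) y≢x
  ... | no _     | there x∈ys = count-⁅⁆ u x∈ys

  count-⁅⁆∪⁅⁆ : ∀ {x y xs} → Unique xs → x ∈ₗ xs → y ∈ₗ xs → x ≢ y →
                 count (⁅ x ⁆ ∪ ⁅ y ⁆) xs ≡ 2
  count-⁅⁆∪⁅⁆ {x} {y} {xs} u x∈ y∈ x≢y = begin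
    count (⁅ x ⁆ ∪ ⁅ y ⁆) xs             ≡⟨ count-∪-disjoint disjoint xs ⟩
    count ⁅ x ⁆ xs ℕ.+ count ⁅ y ⁆ xs    ≡⟨ cong₂ ℕ._+_ (count-⁅⁆ u x∈) (count-⁅⁆ u y∈) ⟩
    2                                     ∎
    where
      open ≡-Reasoning
      disjoint : ∀ z → ⁅ x ⁆ z ≡ true → ⁅ y ⁆ z ≡ false
      disjoint z z∈⁅x⁆ with z ≟ x | z∈⁅x⁆
      ... | yes refl | _ = dec-false (z ≟ y) x≢y

module _ {X : Set} {_∙_ : Op₂ X} {ε : X}
         (isCommutativeMonoid : IsCommutativeMonoid _≡_ _∙_ ε) where

  open IsCommutativeMonoid isCommutativeMonoid using (identityʳ; comm)

  sumWhere : (X → Bool) → List X → X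
  sumWhere P = foldr (λ x acc → if P x then x ∙ acc else acc) ε

  sumWhere-of-count≡0 : ∀ P xs → count P xs ≡ 0 → sumWhere P xs ≡ ε
  sumWhere-of-count≡0 P []       _ = refl
  sumWhere-of-count≡0 P (x ∷ xs) c with P x | c
  ... | true  | ()
  ... | false | c′ = sumWhere-of-count≡0 P xs c′

  sumWhere-of-count≡1 : ∀ P xs → count P xs ≡ 1 →
                        ∃[ x ] x ∈ₗ xs × P x ≡ true × sumWhere P xs ≡ x
  sumWhere-of-count≡1 P (x ∷ xs) c with P x in Px
  ... | true  = x , here refl , Px ,
                trans (cong (x ∙_) (sumWhere-of-count≡0 P xs (ℕₚ.suc-injective c))) (identityʳ x)
  ... | false with sumWhere-of-count≡1 P xs c
  ...   | y , y∈xs , Py , Σ≡y = y , there y∈xs , Py , Σ≡y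

  sumWhere-of-count≡2 : ∀ P {xs} → Unique xs → count P xs ≡ 2 →
                        ∃₂ λ x y → P x ≡ true × P y ≡ true × x ≢ y × sumWhere P xs ≡ x ∙ y
  sumWhere-of-count≡2 P {x ∷ xs} (x∉xs ∷ u) c with P x in Px
  ... | false = sumWhere-of-count≡2 P u c
  ... | true with sumWhere-of-count≡1 P xs (ℕₚ.suc-injective c)
  ...   | y , y∈xs , Py , Σ≡y = x , y , Px , Py , All.lookup x∉xs y∈xs , cong (x ∙_) Σ≡y

  module _ (_≟_ : DecidableEquality X) where
    open Singletons _≟_

    sumWhere-⁅⁆∪⁅⁆ : ∀ {x y xs} → Unique xs → x ∈ₗ xs → y ∈ₗ xs → x ≢ y →
                     sumWhere (⁅ x ⁆ ∪ ⁅ y ⁆) xs ≡ x ∙ y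
    sumWhere-⁅⁆∪⁅⁆ {x} {y} u x∈ y∈ x≢y
      with sumWhere-of-count≡2 (⁅ x ⁆ ∪ ⁅ y ⁆) u (count-⁅⁆∪⁅⁆ u x∈ y∈ x≢y)
    ... | a , b , a∈ , b∈ , a≢b , Σ≡a∙b with ∈⁅⁆∪⁅⁆ a∈ | ∈⁅⁆∪⁅⁆ b∈
    ... | inj₁ refl | inj₁ refl = contradiction refl a≢b
    ... | inj₁ refl | inj₂ refl = Σ≡a∙b
    ... | inj₂ refl | inj₁ refl = trans Σ≡a∙b (comm y x)
    ... | inj₂ refl | inj₂ refl = contradiction refl a≢b

module InversePairs (G : FiniteAbelianGroup) where

  open FiniteAbelianGroup G
  open IsAbelianGroup isAbelianGroup using (inverseʳ; isCommutativeMonoid)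

  abelianGroup : AbelianGroup _ _
  abelianGroup = record { isAbelianGroup = isAbelianGroup }

  open GroupProperties (AbelianGroup.group abelianGroup) using (⁻¹-involutive; inverseʳ-unique)
  open Inverse enum using (to; from; strictlyInverseˡ; strictlyInverseʳ)
  open Singletons _≟_

  elements-unique : Unique elements
  elements-unique = map⁺ (Injection.injective (↔⇒↣ enum)) (allFin⁺ size)

  ∈-elements : ∀ x → x ∈ₗ elements
  ∈-elements x = subst (_∈ₗ elements) (strictlyInverseˡ x) (∈-map⁺ to (∈-allFin (from x)))

  card≡count : ∀ S → card S ≡ count S elements
  card≡count S = length-filter≡count S elements

  count-∘-involution : ∀ {σ : Carrier → Carrier} → (∀ x → σ (σ x) ≡ x) →
                       ∀ P → count (P ∘ σ) elements ≡ count P elements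
  count-∘-involution {σ} σ-involutive P = begin
    count (P ∘ σ) elements          ≡⟨ count-elements (P ∘ σ) ⟩
    sum (indicator ∘ P ∘ σ ∘ to)     ≡⟨ sum-cong-≗ (cong (indicator ∘ P) ∘ sym ∘ strictlyInverseˡ ∘ σ ∘ to) ⟩
    sum (indicator ∘ P ∘ to ∘ π)     ≡⟨ sum-permute (indicator ∘ P ∘ to) (permutation π π π-involutive π-involutive) ⟨
    sum (indicator ∘ P ∘ to)         ≡⟨ count-elements P ⟨
    count P elements                 ∎
    where
      open ≡-Reasoning

      indicator : Bool → ℕ
      indicator b = if b then 1 else 0

      count-elements : ∀ Q → count Q elements ≡ sum (indicator ∘ Q ∘ to)
      count-elements Q = trans (cong (count Q) (map-tabulate id to)) (count-tabulate Q to)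

      π : Fin size → Fin size
      π = from ∘ σ ∘ to

      π-involutive : ∀ i → π (π i) ≡ i
      π-involutive i = begin
        from (σ (to (from (σ (to i)))))  ≡⟨ cong (from ∘ σ) (strictlyInverseˡ (σ (to i))) ⟩
        from (σ (σ (to i)))              ≡⟨ cong from (σ-involutive (to i)) ⟩
        from (to i)                      ≡⟨ strictlyInverseʳ i ⟩
        i                                ∎

  x≢-x⇒∉B : ∀ {x} → x ≢ - x → B x ≡ false
  x≢-x⇒∉B {x} x≢-x = dec-false ((x + x) ≟ 0#) (x≢-x ∘ inverseʳ-unique x x)

  ∉B⇒x≢-x : ∀ {x} → B x ≡ false → x ≢ - x
  ∉B⇒x≢-x {x} x∉B x≡-x =
    contradiction (trans (sym (dec-true ((x + x) ≟ 0#) x+x≡0)) x∉B) λ ()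
    where
      x+x≡0 : x + x ≡ 0#
      x+x≡0 = trans (cong (x +_) x≡-x) (inverseʳ x)

  HasInversePair : Subset → Set
  HasInversePair S = ∃[ x ] x ∈ S × (- x) ∈ S × B x ≡ false

  hasInversePair? : ∀ S → Dec (HasInversePair S)
  hasInversePair? S =
    map′ satisfied (λ (x , pair) → lose (∈-elements x) pair)
      (any? (λ x → S x Bool.≟ true ×-dec S (- x) Bool.≟ true ×-dec B x Bool.≟ false) elements)

  inversePair⇒zeroSum : ∀ {S} → HasInversePair S → HasZeroSumSubset 2 S
  inversePair⇒zeroSum {S} (x , x∈S , -x∈S , x∉B) = ⁅ x ⁆ ∪ ⁅ - x ⁆ , pair⊆S , card≡2 , sum≡0
    where
      x≢-x : x ≢ - x
      x≢-x = ∉B⇒x≢-x x∉B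

      pair⊆S : (⁅ x ⁆ ∪ ⁅ - x ⁆) ⊆ S
      pair⊆S z z∈pair with ∈⁅⁆∪⁅⁆ z∈pair
      ... | inj₁ refl = x∈S
      ... | inj₂ refl = -x∈S

      card≡2 : card (⁅ x ⁆ ∪ ⁅ - x ⁆) ≡ 2
      card≡2 = trans (card≡count _)
        (count-⁅⁆∪⁅⁆ elements-unique (∈-elements x) (∈-elements (- x)) x≢-x)

      sum≡0 : sumOf (⁅ x ⁆ ∪ ⁅ - x ⁆) ≡ 0#
      sum≡0 = trans
        (sumWhere-⁅⁆∪⁅⁆ isCommutativeMonoid _≟_ elements-unique (∈-elements x) (∈-elements (- x)) x≢-x)
        (inverseʳ x)

  zeroSum⇒inversePair : ∀ {S} → HasZeroSumSubset 2 S → HasInversePair S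
  zeroSum⇒inversePair {S} (T , T⊆S , card≡2 , sum≡0)
    with sumWhere-of-count≡2 isCommutativeMonoid T elements-unique (trans (sym (card≡count T)) card≡2)
  ... | x , y , x∈T , y∈T , x≢y , sum≡x+y =
    x , T⊆S x x∈T , subst (_∈ S) y≡-x (T⊆S y y∈T) , x≢-x⇒∉B (λ x≡-x → x≢y (trans x≡-x (sym y≡-x)))
    where
      y≡-x : y ≡ - x
      y≡-x = inverseʳ-unique x y (trans (sym sum≡x+y) sum≡0)

  module _ (A : Subset)
           (partition : ∀ x → (B x ≡ false) ⇔ ((x ∈ A) ⊎ ((- x) ∈ A)))
           (disjoint : ∀ x → ¬ ((x ∈ A) × ((- x) ∈ A))) where

    ∈A⇒∉B : ∀ {x} → x ∈ A → B x ≡ false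
    ∈A⇒∉B {x} x∈A = Equivalence.from (partition x) (inj₁ x∈A)

    ∉B⇒-∉B : ∀ {x} → B x ≡ false → B (- x) ≡ false
    ∉B⇒-∉B {x} x∉B = Equivalence.from (partition (- x))
      (Sum.map₂ (subst (_∈ A) (sym (⁻¹-involutive x))) (Sum.swap (Equivalence.to (partition x) x∉B)))

    ∉B∉A⇒-∈A : ∀ {x} → B x ≡ false → A x ≡ false → (- x) ∈ A
    ∉B∉A⇒-∈A {x} x∉B x∉A with Equivalence.to (partition x) x∉B
    ... | inj₁ x∈A  = contradiction (trans (sym x∈A) x∉A) λ ()
    ... | inj₂ -x∈A = -x∈A

    card-A∪B : card (A ∪ B) ≡ card A ℕ.+ card B
    card-A∪B = begin
      card (A ∪ B)                              ≡⟨ card≡count (A ∪ B) ⟩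
      count (A ∪ B) elements                    ≡⟨ count-∪-disjoint (λ _ → ∈A⇒∉B) elements ⟩
      count A elements ℕ.+ count B elements     ≡⟨ cong₂ ℕ._+_ (card≡count A) (card≡count B) ⟨
      card A ℕ.+ card B                         ∎
      where open ≡-Reasoning

    A∪B-inversePairFree : ¬ HasInversePair (A ∪ B)
    A∪B-inversePairFree (x , x∈A∪B , -x∈A∪B , x∉B) =
      disjoint x (∈A∪B⇒∈A x∈A∪B x∉B , ∈A∪B⇒∈A -x∈A∪B (∉B⇒-∉B x∉B))
      where
        ∈A∪B⇒∈A : ∀ {z} → (A ∪ B) z ≡ true → B z ≡ false → z ∈ A
        ∈A∪B⇒∈A z∈A∪B z∉B with ∪⁻ A B z∈A∪B
        ... | inj₁ z∈A = z∈A
        ... | inj₂ z∈B = contradiction (trans (sym z∈B) z∉B) λ ()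

    card-inversePairFree : ∀ {S} → ¬ HasInversePair S → card S ≤ card A ℕ.+ card B
    card-inversePairFree {S} noPair = begin
      card S                                              ≡⟨ card≡count S ⟩
      # S                                                 ≡⟨ count-split S B elements ⟩
      # (S ∩ B) ℕ.+ # (S ∖ B)                             ≡⟨ cong (# (S ∩ B) ℕ.+_) (count-split (S ∖ B) A elements) ⟩
      # (S ∩ B) ℕ.+ (# ((S ∖ B) ∩ A) ℕ.+ # ((S ∖ B) ∖ A))
        ≡⟨ cong (λ n → # (S ∩ B) ℕ.+ (# ((S ∖ B) ∩ A) ℕ.+ n)) (count-∘-involution ⁻¹-involutive ((S ∖ B) ∖ A)) ⟨
      # (S ∩ B) ℕ.+ (# ((S ∖ B) ∩ A) ℕ.+ # (((S ∖ B) ∖ A) ∘ -_))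
      ≤⟨ ℕₚ.+-mono-≤ (count-mono (λ _ → proj₂ ∘ ∩⁻ S B) elements)
                      (ℕₚ.+-mono-≤ (count-mono S∖B∩A⊆A∩S elements) (count-mono -S∖B∖A⊆A∖S elements)) ⟩
      # B ℕ.+ (# (A ∩ S) ℕ.+ # (A ∖ S))                   ≡⟨ cong (# B ℕ.+_) (count-split A S elements) ⟨
      # B ℕ.+ # A                                         ≡⟨ ℕₚ.+-comm (# B) (# A) ⟩
      # A ℕ.+ # B                                         ≡⟨ cong₂ ℕ._+_ (card≡count A) (card≡count B) ⟨
      card A ℕ.+ card B                                   ∎
      where
        open ℕₚ.≤-Reasoning

        #_ : Subset → ℕ
        # P = count P elements

        S∖B∩A⊆A∩S : ∀ z → ((S ∖ B) ∩ A) z ≡ true → (A ∩ S) z ≡ true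
        S∖B∩A⊆A∩S z z∈ = let (z∈S∖B , z∈A) = ∩⁻ (S ∖ B) A z∈ in ∩⁺ A S z∈A (proj₁ (∖⁻ S B z∈S∖B))

        -S∖B∖A⊆A∖S : ∀ z → ((S ∖ B) ∖ A) (- z) ≡ true → (A ∖ S) z ≡ true
        -S∖B∖A⊆A∖S z -z∈ with ∖⁻ (S ∖ B) A -z∈
        ... | -z∈S∖B , -z∉A with ∖⁻ S B -z∈S∖B
        ...   | -z∈S , -z∉B = ∖⁺ A S z∈A z∉S
          where
            z∈A : z ∈ A
            z∈A = subst (_∈ A) (⁻¹-involutive z) (∉B∉A⇒-∈A -z∉B -z∉A)

            z∉S : S z ≡ false
            z∉S = ¬-not (λ z∈S → noPair (z , z∈S , -z∈S , ∈A⇒∉B z∈A))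

lemma3p1 : (G : FiniteAbelianGroup) → let open FiniteAbelianGroup G hiding (_+_) in
    (A : Subset) →
    (∀ x → (B x ≡ false) ⇔ ((x ∈ A) ⊎ ((- x) ∈ A))) →
    (∀ x → ¬ ((x ∈ A) × ((- x) ∈ A))) →
    IsHarborthConstant 2 ((card A ℕ.+ card B ℕ.+ 1))
lemma3p1 G A partition disjoint = ℕₚ.m≤n+m 1 (card A ℕ.+ card B) , upper , minimal
  where
    open FiniteAbelianGroup G hiding (_+_)
    open InversePairs G

    upper : HarborthProperty 2 (card A ℕ.+ card B ℕ.+ 1)
    upper S bound≤card with hasInversePair? S
    ... | yes pair = inversePair⇒zeroSum pair
    ... | no noPair = contradiction bound≤card
      (ℕₚ.<⇒≱ (subst (card S <_) (ℕₚ.+-comm 1 (card A ℕ.+ card B))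
                 (s≤s (card-inversePairFree A partition disjoint noPair))))

    minimal : ∀ t → 1 ≤ t → HarborthProperty 2 t → card A ℕ.+ card B ℕ.+ 1 ≤ t
    minimal t _ t-suffices = subst (_≤ t) (ℕₚ.+-comm 1 (card A ℕ.+ card B))
      (subst (_< t) (card-A∪B A partition disjoint)
        (ℕₚ.≰⇒> λ t≤card → A∪B-inversePairFree A partition disjoint
                              (zeroSum⇒inversePair (t-suffices (A ∪ B) t≤card))))
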